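{- Let $\mathbb A=(A,+)$ be a cancellative semigroup, and let $X,Y\subseteq A$ be finite sets such that $\langle Y\rangle$ is commutative and $Y^\times\neq\emptyset$. Then the following are equivalent: (i) $X+2Y = X+Y+\bar y$ for some $\bar y\in Y^\times$; (ii) $X+2Y = X+Y+y$ for all $y\in Y$; (iii) $X+\langle\langle Y-\bar y\rangle\rangle = X+\langle Y-\bar y\rangle = X+Y-\bar y$ for every $\bar y\in Y^\times$.
   Context: The semigroup is written additively but need not be commutative. Cancellative: for every $z\in A$ the maps $x\mapsto x+z$ and $x\mapsto z+x$ are injective. For subsets, $X+Y:=\{x+y: x\in X, y\in Y\}$, $2Y:=Y+Y$, and singletons $\{y\}$ are written $y$. $Y^\times$ is the set of elements of $Y$ that are units of $\mathbb A$ (so $Y^\times\ne\emptyset$ forces $\mathbb A$ to be a monoid). For a unit $\bar y$ with inverse $-\bar y$, $Y-\bar y:=\{y+(-\bar y): y\in Y\}$ and $X+Y-\bar y := \{w+(-\bar y): w\in X+Y\}$. $\langle W\rangle$ is the subsemigroup generated by $W$, and $\langle\langle W\rangle\rangle := \langle W\cup\{ -w: w\in W^\times\}\rangle$. -}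

module Defs where

open import Level using (Level; _⊔_; suc)
open import Data.Product using (Σ; ∃; _×_; _,_)
open import Data.List using (List)
open import Data.Sum using (_⊎_)
open import Data.List.Membership.Propositional using (_∈_)
open import Relation.Binary.PropositionalEquality using (_≡_)

record CancellativeSemigroup (a : Level) : Set (suc a) where
  infixl 6 _+_
  field
    Carrier  : Set a
    _+_      : Carrier → Carrier → Carrier
    assoc    : ∀ x y z → (x + y) + z ≡ x + (y + z)
    cancelʳ  : ∀ z {x x′} → x + z ≡ x′ + z → x ≡ x′
    cancelˡ  : ∀ z {x x′} → z + x ≡ z + x′ → x ≡ x′

module Notions {a : Level} (𝔸 : CancellativeSemigroup a) where
  open CancellativeSemigroup 𝔸 public

  Subset : Set (suc a)
  Subset = Carrier → Set a

  ⟦_⟧ : List Carrier → Subset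
  ⟦ L ⟧ x = x ∈ L

  ｛_｝ : Carrier → Subset
  ｛ y ｝ x = x ≡ y

  infix 4 _≐_
  _≐_ : Subset → Subset → Set a
  X ≐ Y = ∀ x → (X x → Y x) × (Y x → X x)

  infixl 6 _⊕_
  _⊕_ : Subset → Subset → Subset
  (X ⊕ Y) w = Σ Carrier λ x → Σ Carrier λ y → X x × Y y × w ≡ x + y

  2·_ : Subset → Subset
  2· Y = Y ⊕ Y

  IsIdentity : Carrier → Set a
  IsIdentity e = ∀ x → (e + x ≡ x) × (x + e ≡ x)

  IsInverseOf : Carrier → Carrier → Set a
  IsInverseOf v u = Σ Carrier λ e → IsIdentity e × (u + v ≡ e) × (v + u ≡ e)

  IsUnit : Carrier → Set a
  IsUnit u = Σ Carrier λ v → IsInverseOf v u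

  _ˣ : Subset → Subset
  (Y ˣ) u = Y u × IsUnit u

  negUnits : Subset → Subset
  negUnits W v = Σ Carrier λ w → (W ˣ) w × IsInverseOf v w

  infixl 5 _∪_
  _∪_ : Subset → Subset → Subset
  (X ∪ Y) x = X x ⊎ Y x

  data ⟨_⟩ (W : Subset) : Subset where
    gen : ∀ {x} → W x → ⟨ W ⟩ x
    add : ∀ {x y} → ⟨ W ⟩ x → ⟨ W ⟩ y → ⟨ W ⟩ (x + y)

  ⟨⟨_⟩⟩ : Subset → Subset
  ⟨⟨ W ⟩⟩ = ⟨ W ∪ negUnits W ⟩

  Commutative : Subset → Set a
  Commutative S = ∀ {x y} → S x → S y → x + y ≡ y + x

  -- Z - ȳ := { z + (-ȳ) : z ∈ Z }, where the inverse -ȳ is passed explicitly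
  _⊖_ : Subset → Carrier → Subset
  (Z ⊖ m) w = Σ Carrier λ z → Z z × w ≡ z + m

-- Fix a unit ȳ ∈ Y with inverse m and put Z = Y - ȳ, S = X + Z = X + Y - ȳ.
-- Each of (i), (ii), (iii) at ȳ is equivalent to S + Z ⊆ S.  Since S is finite,
-- if S + z ⊆ S then the orbit s, s + z, s + 2z, … repeats, and by cancellation some
-- multiple of z is its inverse; so S is absorbing for all of ⟨⟨Z⟩⟩, not only for Z.
module Submission where

open import Defs
open import Level using (Level)
open import Function using (_∘_)
open import Data.Product using (Σ; ∃₂; _×_; _,_; proj₁; proj₂)
open import Data.Sum using (inj₁; inj₂)
open import Data.Nat using (ℕ; zero; suc; _<_) renaming (_+_ to _+ℕ_)
open import Data.Nat.Properties using (n<1+n; +-suc; +-comm; m≤n⇒∃[o]m+o≡n)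
open import Data.Fin using (toℕ)
open import Data.Fin.Properties using (pigeonhole)
open import Data.List using (List; length; lookup; map; cartesianProductWith)
open import Data.List.Membership.Propositional using (_∈_)
open import Data.List.Membership.Propositional.Properties using (∈-map⁺; ∈-cartesianProductWith⁺)
open import Data.List.Relation.Unary.Any using (index)
open import Data.List.Relation.Unary.Any.Properties using (lookup-index)
open import Relation.Binary.PropositionalEquality using (_≡_; refl; sym; trans; cong; cong₂; subst; isEquivalence; module ≡-Reasoning)
open import Algebra.Bundles using (Monoid)
import Algebra.Properties.Monoid.Mult as MonoidMult

list-pigeonhole : ∀ {ℓ} {A : Set ℓ} (L : List A) (f : ℕ → A) →
                  (∀ k → f k ∈ L) → ∃₂ λ i j → i < j × f i ≡ f j
list-pigeonhole L f f∈L
  with i , j , i<j , same-index ← pigeonhole (n<1+n (length L)) (index ∘ f∈L ∘ toℕ) =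
  toℕ i , toℕ j , i<j ,
  trans (lookup-index (f∈L (toℕ i)))
        (trans (cong (lookup L) same-index) (sym (lookup-index (f∈L (toℕ j)))))

module Development {a : Level} (𝔸 : CancellativeSemigroup a) where
  open Notions 𝔸 public
  open ≡-Reasoning

  infix 4 _⊆_
  _⊆_ : Subset → Subset → Set a
  X ⊆ Y = ∀ {x} → X x → Y x

  ⊆-antisym : ∀ {X Y} → X ⊆ Y → Y ⊆ X → X ≐ Y
  ⊆-antisym X⊆Y Y⊆X _ = X⊆Y , Y⊆X

  ≐⇒⊆ : ∀ {X Y} → X ≐ Y → X ⊆ Y
  ≐⇒⊆ X≐Y = proj₁ (X≐Y _)

  Finite : Subset → Set a
  Finite S = Σ (List Carrier) λ L → S ⊆ ⟦ L ⟧

  ⟦⟧-finite : ∀ L → Finite ⟦ L ⟧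
  ⟦⟧-finite L = L , λ x∈L → x∈L

  ⊕-finite : ∀ {X Y} → Finite X → Finite Y → Finite (X ⊕ Y)
  ⊕-finite (LX , X⊆LX) (LY , Y⊆LY) =
    cartesianProductWith _+_ LX LY ,
    λ { (x , y , x∈X , y∈Y , refl) → ∈-cartesianProductWith⁺ _+_ (X⊆LX x∈X) (Y⊆LY y∈Y) }

  ⊖-finite : ∀ {Y} m → Finite Y → Finite (Y ⊖ m)
  ⊖-finite m (LY , Y⊆LY) = map (_+ m) LY , λ { (y , y∈Y , refl) → ∈-map⁺ (_+ m) (Y⊆LY y∈Y) }

  ⊕-monoʳ : ∀ {X W W′} → W ⊆ W′ → X ⊕ W ⊆ X ⊕ W′
  ⊕-monoʳ W⊆W′ (x , g , x∈X , g∈W , eq) = x , g , x∈X , W⊆W′ g∈W , eq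

  ⟨⟩-mono : ∀ {W W′} → W ⊆ W′ → ⟨ W ⟩ ⊆ ⟨ W′ ⟩
  ⟨⟩-mono W⊆W′ (gen w∈W) = gen (W⊆W′ w∈W)
  ⟨⟩-mono W⊆W′ (add p q) = add (⟨⟩-mono W⊆W′ p) (⟨⟩-mono W⊆W′ q)

  ⊕-⊖-assoc : ∀ {X Y} m → X ⊕ (Y ⊖ m) ⊆ (X ⊕ Y) ⊖ m
  ⊕-⊖-assoc m (x , _ , x∈X , (y , y∈Y , refl) , refl) =
    x + y , (x , y , x∈X , y∈Y , refl) , sym (assoc x y m)

  ⊕-⊖-assoc⁻ : ∀ {X Y} m → (X ⊕ Y) ⊖ m ⊆ X ⊕ (Y ⊖ m)
  ⊕-⊖-assoc⁻ m (_ , (x , y , x∈X , y∈Y , refl) , refl) =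
    x , y + m , x∈X , (y , y∈Y , refl) , assoc x y m

  ⊕-singleton⊆⊕2· : ∀ {X Y y} → Y y → X ⊕ Y ⊕ ｛ y ｝ ⊆ X ⊕ 2· Y
  ⊕-singleton⊆⊕2· {y = y} y∈Y (_ , _ , (x , y₁ , x∈X , y₁∈Y , refl) , refl , refl) =
    x , y₁ + y , x∈X , (y₁ , y , y₁∈Y , y∈Y , refl) , assoc x y₁ y

  ClosedUnder : Subset → Subset → Set a
  ClosedUnder S W = ∀ {w g} → S w → W g → S (w + g)

  closedUnder-⟨⟩ : ∀ {S W} → ClosedUnder S W → ClosedUnder S ⟨ W ⟩
  closedUnder-⟨⟩ cl s (gen g∈W) = cl s g∈W
  closedUnder-⟨⟩ {S} {W} cl {w} s (add {g₁} {g₂} p q) =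
    subst S (assoc w g₁ g₂) (closedUnder-⟨⟩ {S} {W} cl (closedUnder-⟨⟩ {S} {W} cl s p) q)

  ⊕⟨⟩-closedUnder : ∀ {X W} → ClosedUnder (X ⊕ ⟨ W ⟩) W
  ⊕⟨⟩-closedUnder {g = g} (x , h , x∈X , h∈⟨W⟩ , refl) g∈W =
    x , h + g , x∈X , add h∈⟨W⟩ (gen g∈W) , assoc x h g

  closed⇒⊕⊆ : ∀ {X G S} → X ⊆ S → ClosedUnder S G → X ⊕ G ⊆ S
  closed⇒⊕⊆ {S = S} X⊆S cl (x , g , x∈X , g∈G , eq) = subst S (sym eq) (cl (X⊆S x∈X) g∈G)

  shift-twice : ∀ {x u y m} → m + y ≡ y + m → (x + (u + m)) + (y + m) ≡ (((x + u) + y) + m) + m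
  shift-twice {x} {u} {y} {m} m+y≡y+m = begin
    (x + (u + m)) + (y + m)  ≡⟨ cong (_+ (y + m)) (sym (assoc x u m)) ⟩
    ((x + u) + m) + (y + m)  ≡⟨ sym (assoc ((x + u) + m) y m) ⟩
    (((x + u) + m) + y) + m  ≡⟨ cong (_+ m) (assoc (x + u) m y) ⟩
    ((x + u) + (m + y)) + m  ≡⟨ cong (λ v → ((x + u) + v) + m) m+y≡y+m ⟩
    ((x + u) + (y + m)) + m  ≡⟨ cong (_+ m) (sym (assoc (x + u) y m)) ⟩
    (((x + u) + y) + m) + m  ∎

  identity-unique : ∀ {e e′} → IsIdentity e → IsIdentity e′ → e′ ≡ e
  identity-unique {e} {e′} e-id e′-id = trans (sym (proj₁ (e-id e′))) (proj₂ (e′-id e))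

  module WithIdentity {e : Carrier} (isId : IsIdentity e) where

    +-identityˡ : ∀ x → e + x ≡ x
    +-identityˡ x = proj₁ (isId x)

    +-identityʳ : ∀ x → x + e ≡ x
    +-identityʳ x = proj₂ (isId x)

    monoid : Monoid a a
    monoid = record
      { Carrier  = Carrier
      ; _≈_      = _≡_
      ; _∙_      = _+_
      ; ε        = e
      ; isMonoid = record
        { isSemigroup = record
          { isMagma = record { isEquivalence = isEquivalence ; ∙-cong = cong₂ _+_ }
          ; assoc   = assoc }
        ; identity = +-identityˡ , +-identityʳ } }

    open MonoidMult monoid using (×-homo-+) renaming (_×_ to _·_)

    inverse-laws : ∀ {u m} → IsInverseOf m u → (u + m ≡ e) × (m + u ≡ e)
    inverse-laws (e′ , e′-id , u+m≡e′ , m+u≡e′) =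
      trans u+m≡e′ (identity-unique isId e′-id) , trans m+u≡e′ (identity-unique isId e′-id)

    inverse-unique : ∀ {g z t} → g + z ≡ e → z + t ≡ e → g ≡ t
    inverse-unique {g} {z} {t} g+z≡e z+t≡e = begin
      g              ≡⟨ sym (+-identityʳ g) ⟩
      g + e          ≡⟨ cong (g +_) (sym z+t≡e) ⟩
      g + (z + t)    ≡⟨ sym (assoc g z t) ⟩
      (g + z) + t    ≡⟨ cong (_+ t) g+z≡e ⟩
      e + t          ≡⟨ +-identityˡ t ⟩
      t              ∎

    inverse-cancelʳ : ∀ {c u m} → u + m ≡ e → (c + u) + m ≡ c
    inverse-cancelʳ {c} {u} {m} u+m≡e =
      trans (assoc c u m) (trans (cong (c +_) u+m≡e) (+-identityʳ c))

    inverse-comm : ∀ {u m y} → u + m ≡ e → m + u ≡ e → u + y ≡ y + u → m + y ≡ y + m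
    inverse-comm {u} {m} {y} u+m≡e m+u≡e u+y≡y+u = begin
      m + y              ≡⟨ sym (inverse-cancelʳ u+m≡e) ⟩
      ((m + y) + u) + m  ≡⟨ cong (_+ m) (assoc m y u) ⟩
      (m + (y + u)) + m  ≡⟨ cong (λ v → (m + v) + m) (sym u+y≡y+u) ⟩
      (m + (u + y)) + m  ≡⟨ cong (_+ m) (sym (assoc m u y)) ⟩
      ((m + u) + y) + m  ≡⟨ cong (λ v → (v + y) + m) m+u≡e ⟩
      (e + y) + m        ≡⟨ cong (_+ m) (+-identityˡ y) ⟩
      y + m              ∎

    ·-comm : ∀ z n → z + n · z ≡ n · z + z
    ·-comm z n = begin
      suc n · z       ≡⟨ cong (_· z) (+-comm 1 n) ⟩
      (n +ℕ 1) · z    ≡⟨ ×-homo-+ z n 1 ⟩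
      n · z + 1 · z   ≡⟨ cong (n · z +_) (+-identityʳ z) ⟩
      n · z + z       ∎

    ·-period : ∀ v z i n → v + i · z ≡ v + (i +ℕ n) · z → n · z ≡ e
    ·-period v z i n same = sym (cancelˡ (v + i · z) (begin
      (v + i · z) + e      ≡⟨ +-identityʳ (v + i · z) ⟩
      v + i · z            ≡⟨ same ⟩
      v + (i +ℕ n) · z     ≡⟨ cong (v +_) (×-homo-+ z i n) ⟩
      v + (i · z + n · z)  ≡⟨ sym (assoc v (i · z) (n · z)) ⟩
      (v + i · z) + n · z  ∎))

    closedUnder-· : ∀ {S z w} → ClosedUnder S ｛ z ｝ → S w → ∀ n → S (w + n · z)
    closedUnder-· {S} {w = w} cl s zero = subst S (sym (+-identityʳ w)) s
    closedUnder-· {S} {z} {w} cl s (suc n) = subst S (assoc w z (n · z)) (closedUnder-· {S} {z} cl (cl s refl) n)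

    -- The inverse is the multiple t = d · z read off a repetition v + i · z = v + (i + 1 + d) · z.
    finite-closed⇒inverse : ∀ {S z v} → Finite S → S v → ClosedUnder S ｛ z ｝ →
      Σ Carrier λ t → (t + z ≡ e) × (z + t ≡ e) × ClosedUnder S ｛ t ｝
    finite-closed⇒inverse {S} {z} {v} (L , S⊆L) v∈S cl
      with i , j , i<j , same ← list-pigeonhole L (λ k → v + k · z) (S⊆L ∘ closedUnder-· {S} {z} cl v∈S)
      with d , i+1+d≡j ← m≤n⇒∃[o]m+o≡n i<j =
      d · z , trans (sym (·-comm z d)) z+d·z≡e , z+d·z≡e ,
      λ { s refl → closedUnder-· {S} {z} cl s d }
      where
      z+d·z≡e : z + d · z ≡ e
      z+d·z≡e = ·-period v z i (suc d)
        (trans same (cong (λ k → v + k · z) (trans (sym i+1+d≡j) (sym (+-suc i d)))))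

    closedUnder-⟨⟨⟩⟩ : ∀ {S W} → Finite S → ClosedUnder S W → ClosedUnder S ⟨⟨ W ⟩⟩
    closedUnder-⟨⟨⟩⟩ {S} {W} S-finite cl = closedUnder-⟨⟩ {S} {W ∪ negUnits W} closed-∪
      where
      closed-∪ : ClosedUnder S (W ∪ negUnits W)
      closed-∪ s (inj₁ g∈W) = cl s g∈W
      closed-∪ s (inj₂ (z , (z∈W , _) , g-inv))
        with t , _ , z+t≡e , closed-t ← finite-closed⇒inverse S-finite s (λ { s′ refl → cl s′ z∈W }) =
        closed-t s (inverse-unique (proj₂ (inverse-laws g-inv)) z+t≡e)

    module Translate (Xs Ys : List Carrier) (comm : Commutative ⟨ ⟦ Ys ⟧ ⟩)
                     {ȳ m : Carrier} (ȳ∈Y : ⟦ Ys ⟧ ȳ) (m-inv : IsInverseOf m ȳ) where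

      X Y Z S : Subset
      X = ⟦ Xs ⟧
      Y = ⟦ Ys ⟧
      Z = Y ⊖ m
      S = X ⊕ Z

      ȳ+m≡e : ȳ + m ≡ e
      ȳ+m≡e = proj₁ (inverse-laws m-inv)

      m-comm : ∀ {y} → Y y → m + y ≡ y + m
      m-comm y∈Y = inverse-comm ȳ+m≡e (proj₂ (inverse-laws m-inv)) (comm (gen ȳ∈Y) (gen y∈Y))

      S-finite : Finite S
      S-finite = ⊕-finite (⟦⟧-finite Xs) (⊖-finite m (⟦⟧-finite Ys))

      X⊆S : X ⊆ S
      X⊆S {x} x∈X = x , e , x∈X , (ȳ , ȳ∈Y , sym ȳ+m≡e) , sym (+-identityʳ x)

      S⊆X⊕⟨Z⟩ : S ⊆ X ⊕ ⟨ Z ⟩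
      S⊆X⊕⟨Z⟩ = ⊕-monoʳ gen

      shift⇒closed : X ⊕ 2· Y ⊆ X ⊕ Y ⊕ ｛ ȳ ｝ → ClosedUnder S Z
      shift⇒closed X⊕2Y⊆ (x , _ , x∈X , (y₁ , y₁∈Y , refl) , refl) (y₂ , y₂∈Y , refl)
        with X⊕2Y⊆ (x , y₁ + y₂ , x∈X , (y₁ , y₂ , y₁∈Y , y₂∈Y , refl) , refl)
      ... | _ , _ , (x′ , y′ , x′∈X , y′∈Y , refl) , refl , x+y₁+y₂≡ =
        x′ , y′ + m , x′∈X , (y′ , y′∈Y , refl) , (begin
          (x + (y₁ + m)) + (y₂ + m)      ≡⟨ shift-twice (m-comm y₂∈Y) ⟩
          (((x + y₁) + y₂) + m) + m      ≡⟨ cong (λ v → (v + m) + m) (assoc x y₁ y₂) ⟩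
          ((x + (y₁ + y₂)) + m) + m      ≡⟨ cong (λ v → (v + m) + m) x+y₁+y₂≡ ⟩
          ((((x′ + y′) + ȳ) + m) + m)    ≡⟨ cong (_+ m) (inverse-cancelʳ ȳ+m≡e) ⟩
          (x′ + y′) + m                  ≡⟨ assoc x′ y′ m ⟩
          x′ + (y′ + m)                  ∎)

      -- With t the inverse of y - ȳ: w - 2ȳ = (w - 2ȳ + t) + (y - ȳ), and w - 2ȳ + t ∈ S.
      closed⇒shift⊆ : ClosedUnder S Z → ∀ {y} → Y y → X ⊕ 2· Y ⊆ X ⊕ Y ⊕ ｛ y ｝
      closed⇒shift⊆ cl {y} y∈Y (x , _ , x∈X , (y₁ , y₂ , y₁∈Y , y₂∈Y , refl) , refl)
        with t , t+z≡e , _ , closed-t ←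
               finite-closed⇒inverse S-finite (X⊆S x∈X) (λ { s refl → cl s (y , y∈Y , refl) })
        with x₃ , _ , x₃∈X , (y₃ , y₃∈Y , refl) , w+t≡ ←
               closed-t (cl (x , y₁ + m , x∈X , (y₁ , y₁∈Y , refl) , refl) (y₂ , y₂∈Y , refl)) refl =
        x₃ + y₃ , y , (x₃ , y₃ , x₃∈X , y₃∈Y , refl) , refl ,
        cancelʳ m (cancelʳ m (begin
          ((x + (y₁ + y₂)) + m) + m      ≡⟨ cong (λ v → (v + m) + m) (sym (assoc x y₁ y₂)) ⟩
          (((x + y₁) + y₂) + m) + m      ≡⟨ sym (shift-twice (m-comm y₂∈Y)) ⟩
          w                              ≡⟨ sym (inverse-cancelʳ t+z≡e) ⟩
          (w + t) + (y + m)              ≡⟨ cong (_+ (y + m)) w+t≡ ⟩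
          (x₃ + (y₃ + m)) + (y + m)      ≡⟨ shift-twice (m-comm y∈Y) ⟩
          (((x₃ + y₃) + y) + m) + m      ∎))
        where
        w : Carrier
        w = (x + (y₁ + m)) + (y₂ + m)

      closed⇒shift : ClosedUnder S Z → ∀ y → Y y → X ⊕ 2· Y ≐ X ⊕ Y ⊕ ｛ y ｝
      closed⇒shift cl y y∈Y = ⊆-antisym (closed⇒shift⊆ cl y∈Y) (⊕-singleton⊆⊕2· y∈Y)

      closed⇒collapse : ClosedUnder S Z →
        (X ⊕ ⟨⟨ Z ⟩⟩ ≐ X ⊕ ⟨ Z ⟩) × (X ⊕ ⟨ Z ⟩ ≐ (X ⊕ Y) ⊖ m)
      closed⇒collapse cl =
        ⊆-antisym (S⊆X⊕⟨Z⟩ ∘ closed⇒⊕⊆ X⊆S (closedUnder-⟨⟨⟩⟩ S-finite cl)) (⊕-monoʳ (⟨⟩-mono inj₁)) ,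
        ⊆-antisym (⊕-⊖-assoc m ∘ closed⇒⊕⊆ X⊆S (closedUnder-⟨⟩ {S} {Z} cl)) (S⊆X⊕⟨Z⟩ ∘ ⊕-⊖-assoc⁻ m)

      collapse⇒closed : X ⊕ ⟨ Z ⟩ ⊆ (X ⊕ Y) ⊖ m → ClosedUnder S Z
      collapse⇒closed X⊕⟨Z⟩⊆ s z∈Z = ⊕-⊖-assoc⁻ m (X⊕⟨Z⟩⊆ (⊕⟨⟩-closedUnder (S⊆X⊕⟨Z⟩ s) z∈Z))

proposition3 : {a : Level} (𝔸 : CancellativeSemigroup a) →
    let open Notions 𝔸 in
    (Xs Ys : List Carrier) →
    Commutative ⟨ ⟦ Ys ⟧ ⟩ →
    Σ Carrier (λ u → (⟦ Ys ⟧ ˣ) u) →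
    let X = ⟦ Xs ⟧
        Y = ⟦ Ys ⟧
        cond-i = Σ Carrier λ ȳ → (Y ˣ) ȳ × (X ⊕ 2· Y ≐ X ⊕ Y ⊕ ｛ ȳ ｝)
        cond-ii = ∀ y → Y y → X ⊕ 2· Y ≐ X ⊕ Y ⊕ ｛ y ｝
        cond-iii = ∀ ȳ → (Y ˣ) ȳ → ∀ m → IsInverseOf m ȳ →
                     (X ⊕ ⟨⟨ Y ⊖ m ⟩⟩ ≐ X ⊕ ⟨ Y ⊖ m ⟩)
                     × (X ⊕ ⟨ Y ⊖ m ⟩ ≐ (X ⊕ Y) ⊖ m)
    in ((cond-i → cond-ii) × (cond-ii → cond-i))
       × ((cond-ii → cond-iii) × (cond-iii → cond-ii))
proposition3 𝔸 Xs Ys comm (u , u∈Y , m , u-inv@(_ , isId , _)) =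
  (i⇒ii , ii⇒i) , (ii⇒iii , iii⇒ii)
  where
  open Development 𝔸
  open WithIdentity isId
  open Translate Xs Ys comm using (shift⇒closed; closed⇒shift; closed⇒collapse; collapse⇒closed)

  X Y : Subset
  X = ⟦ Xs ⟧
  Y = ⟦ Ys ⟧

  i⇒ii : (Σ Carrier λ ȳ → (Y ˣ) ȳ × (X ⊕ 2· Y ≐ X ⊕ Y ⊕ ｛ ȳ ｝)) →
         ∀ y → Y y → X ⊕ 2· Y ≐ X ⊕ Y ⊕ ｛ y ｝
  i⇒ii (ȳ , (ȳ∈Y , _ , inv) , shift) = closed⇒shift ȳ∈Y inv (shift⇒closed ȳ∈Y inv (≐⇒⊆ shift))

  ii⇒i : (∀ y → Y y → X ⊕ 2· Y ≐ X ⊕ Y ⊕ ｛ y ｝) →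
         Σ Carrier λ ȳ → (Y ˣ) ȳ × (X ⊕ 2· Y ≐ X ⊕ Y ⊕ ｛ ȳ ｝)
  ii⇒i shift = u , (u∈Y , m , u-inv) , shift u u∈Y

  ii⇒iii : (∀ y → Y y → X ⊕ 2· Y ≐ X ⊕ Y ⊕ ｛ y ｝) →
           ∀ ȳ → (Y ˣ) ȳ → ∀ m → IsInverseOf m ȳ →
           (X ⊕ ⟨⟨ Y ⊖ m ⟩⟩ ≐ X ⊕ ⟨ Y ⊖ m ⟩) × (X ⊕ ⟨ Y ⊖ m ⟩ ≐ (X ⊕ Y) ⊖ m)
  ii⇒iii shift ȳ (ȳ∈Y , _) _ inv =
    closed⇒collapse ȳ∈Y inv (shift⇒closed ȳ∈Y inv (≐⇒⊆ (shift ȳ ȳ∈Y)))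

  iii⇒ii : (∀ ȳ → (Y ˣ) ȳ → ∀ m → IsInverseOf m ȳ →
             (X ⊕ ⟨⟨ Y ⊖ m ⟩⟩ ≐ X ⊕ ⟨ Y ⊖ m ⟩) × (X ⊕ ⟨ Y ⊖ m ⟩ ≐ (X ⊕ Y) ⊖ m)) →
           ∀ y → Y y → X ⊕ 2· Y ≐ X ⊕ Y ⊕ ｛ y ｝
  iii⇒ii collapse =
    closed⇒shift u∈Y u-inv (collapse⇒closed u∈Y u-inv (≐⇒⊆ (proj₂ (collapse u (u∈Y , m , u-inv) m u-inv))))
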